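{- Let $n,s$ be positive integers, $1=x_1<x_2<\cdots<x_s<x_{s+1}=n$ integers, and $d\ge2$ an integer. For $1\le i\le s$, let $\beta_i$ be the string consisting of the first $\lfloor\log_d\frac{n}{x_{i+1}-x_i}\rfloor+2$ digits after the base-$d$ point in the base-$d$ representation of $\frac{x_i+x_{i+1}}{dn}$ (the strings $\beta_1,\ldots,\beta_s$ are prefix-free). Let $T$ be the $d$-ary trie of $\beta_1,\ldots,\beta_s$, with each node's children ordered by their digit in $[0,d-1]$, and call the leaf whose path label is $\beta_i$ the $i$th leaf. Then, given $l$ and $r$ with $1\le l<r\le s$, there exist $d'\le d$ nodes $v_1,\ldots,v_{d'}$ of $T$, each at depth at least $\log_d\frac{n}{x_r+x_{r+1}-x_l-x_{l+1}}$, whose subtrees together contain the $l$th through $r$th leaves. Furthermore, the lowest common ancestor $u$ of the $l$th and $r$th leaves satisfies (i) $\mathrm{lca}(v_a,v_b)=u$ for all $1\le a<b\le d'$, and (ii) for all $1<a<d'$, every node strictly between $u$ and $v_a$ on the path from $u$ to $v_a$ has exactly one child.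
   Context: $\mathrm{lca}(v_a,v_b)$ denotes the lowest common ancestor in $T$ of nodes $v_a$ and $v_b$. -}

module Defs where

open import Data.Nat using (ℕ; zero; suc; _+_; _*_; _∸_; _^_; _≤_; _<_; _≤?_; NonZero; >-nonZero)
open import Data.Nat.DivMod using (_/_; _%_)
open import Data.Nat.Properties using (m*n≢0)
open import Data.List using (List; []; _∷_; _++_; [_]; map; upTo; filter; length)
open import Data.Product using (Σ; _×_)
open import Relation.Binary.PropositionalEquality using (_≡_; _≢_)
open import Relation.Nullary using (yes; no)

Prefix : List ℕ → List ℕ → Set
Prefix w v = Σ (List ℕ) λ t → w ++ t ≡ v

StrictPrefix : List ℕ → List ℕ → Set
StrictPrefix w v = Prefix w v × w ≢ v

-- longest common prefix: the path label of the lowest common ancestor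
lcp : List ℕ → List ℕ → List ℕ
lcp [] _ = []
lcp (_ ∷ _) [] = []
lcp (a ∷ as) (b ∷ bs) with Data.Nat._≟_ a b
... | yes _ = a ∷ lcp as bs
... | no _ = []

-- ⌊ log_d (n / m) ⌋ for d ≥ 2, 1 ≤ m ≤ n :
-- the largest k ≥ 0 with d ^ k * m ≤ n, computed as the number of
-- k ∈ {1, …, n} with d ^ k * m ≤ n (the condition is monotone in k and fails for k > n).
floorLog : (d n m : ℕ) → ℕ
floorLog d n m = length (filter (λ k → d ^ k * m ≤? n) (map suc (upTo n)))

module Trie (d n : ℕ) (2≤d : 2 ≤ d) (0<n : 0 < n) (x : ℕ → ℕ) (s : ℕ) where

  private
    instance
      nzd : NonZero d
      nzd = >-nonZero (Data.Nat.Properties.≤-trans (Data.Nat.s≤s Data.Nat.z≤n) 2≤d)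
      nzn : NonZero n
      nzn = >-nonZero 0<n
      nzdn : NonZero (d * n)
      nzdn = m*n≢0 d n

  -- j-th digit (j ≥ 1) after the base-d point of the rational A / (d n):
  -- ⌊ A d^j / (d n) ⌋ mod d
  digit : ℕ → ℕ → ℕ
  digit A j = ((A * d ^ j) / (d * n)) % d

  β : ℕ → List ℕ
  β i = map (λ j → digit (x i + x (suc i)) j)
            (map suc (upTo (floorLog d n (x (suc i) ∸ x i) + 2)))

  -- nodes of the d-ary trie T of β_1, …, β_s, identified with their path labels
  IsNode : List ℕ → Set
  IsNode w = Σ ℕ λ i → 1 ≤ i × i ≤ s × Prefix w (β i)

  OneChild : List ℕ → Set
  OneChild w = Σ ℕ λ c → c < d × IsNode (w ++ [ c ]) ×
                 ((c' : ℕ) → c' < d → IsNode (w ++ [ c' ]) → c' ≡ c)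

-- Write A i = x i + x (suc i), so that β i lists the leading base-d digits of
-- A i / (d n), and let D = A r − A l. Choose k minimal with n ≤ d ^ k * D. Then
-- D * d ^ k ≤ d * n, so as i runs over [l, r] the numbers ⌊A i d ^ k / (d n)⌋,
-- which determine the first k digits, take only the two values attained at
-- i = l and i = r. Every gap x (suc i) − x i is at most D, so β i has at least
-- k digits, and the length-k prefixes of β l, …, β r are at most two nodes of
-- depth k. With d' ≤ 2 condition (ii) is vacuous, and (i) says that two
-- distinct truncations of β l and β r branch where β l and β r do.
module Submission where

open import Defs
open import Data.Nat using (ℕ; zero; suc; _+_; _*_; _∸_; _^_; _≤_; _<_; z≤n; s≤s; z<s; NonZero; >-nonZero; _≤?_; _≟_)
open import Data.Nat.Properties
open import Data.Nat.DivMod using (_/_; _%_; /-monoˡ-≤; m/n/o≡m/[n*o]; m*n/o*n≡m/o; m/n≡1+[m∸n]/n)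
open import Data.Nat.Induction using (<-rec)
open import Data.Fin using (Fin; zero; suc; toℕ)
open import Data.List using (List; []; _∷_; length; map; applyUpTo; filter; take; drop)
open import Data.List.Properties using (map-upTo; map-applyUpTo; length-applyUpTo; filter-accept; take++drop≡id; ≡-dec)
open import Data.Product using (Σ; _×_; _,_)
open import Data.Sum using (_⊎_; inj₁; inj₂)
open import Data.Empty using (⊥-elim)
open import Function using (_∘_)
open import Relation.Nullary using (yes; no; ¬_)
open import Relation.Unary using (Pred; Decidable)
open import Relation.Binary.PropositionalEquality using (_≡_; _≢_; refl; sym; trans; cong; cong₂; subst; module ≡-Reasoning)

take-applyUpTo : ∀ {a} {A : Set a} (f : ℕ → A) {k m} → k ≤ m → take k (applyUpTo f m) ≡ applyUpTo f k
take-applyUpTo f z≤n = refl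
take-applyUpTo f (s≤s k≤m) = cong (f 0 ∷_) (take-applyUpTo (f ∘ suc) k≤m)

applyUpTo-cong : ∀ {a} {A : Set a} {f g : ℕ → A} k → (∀ {j} → j < k → f j ≡ g j) → applyUpTo f k ≡ applyUpTo g k
applyUpTo-cong zero f≗g = refl
applyUpTo-cong (suc k) f≗g = cong₂ _∷_ (f≗g z<s) (applyUpTo-cong k (f≗g ∘ s≤s))

length-filter-applyUpTo-≥ : ∀ {p} {P : Pred ℕ p} (P? : Decidable P) (f : ℕ → ℕ) {m n} → m ≤ n →
                            (∀ {j} → j < m → P (f j)) → m ≤ length (filter P? (applyUpTo f n))
length-filter-applyUpTo-≥ P? f z≤n _ = z≤n
length-filter-applyUpTo-≥ P? f {suc m} {suc n} (s≤s m≤n) P∘f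
  rewrite filter-accept P? {f 0} {applyUpTo (f ∘ suc) n} (P∘f z<s) =
  s≤s (length-filter-applyUpTo-≥ P? (f ∘ suc) m≤n (P∘f ∘ s≤s))

take-Prefix : ∀ k (xs : List ℕ) → Prefix (take k xs) xs
take-Prefix k xs = drop k xs , take++drop≡id k xs

take≡⇒Prefix : ∀ {k} {xs w : List ℕ} → take k xs ≡ w → Prefix w xs
take≡⇒Prefix {k} {xs} refl = take-Prefix k xs

lcp-take : ∀ k (xs ys : List ℕ) → take k xs ≢ take k ys → lcp (take k xs) (take k ys) ≡ lcp xs ys
lcp-take zero xs ys differ = ⊥-elim (differ refl)
lcp-take (suc k) [] [] differ = ⊥-elim (differ refl)
lcp-take (suc k) [] (y ∷ ys) differ = refl
lcp-take (suc k) (x ∷ xs) [] differ = refl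
lcp-take (suc k) (x ∷ xs) (y ∷ ys) differ with x ≟ y
... | yes refl = cong (x ∷_) (lcp-take k xs ys (differ ∘ cong (x ∷_)))
... | no _ = refl

Minimal : ∀ {p} → Pred ℕ p → Pred ℕ p
Minimal P k = P k × (∀ {j} → j < k → ¬ P j)

least-witness : ∀ {p} {P : Pred ℕ p} → Decidable P → ∀ t → P t → Σ ℕ (Minimal P)
least-witness {P = P} P? = <-rec (λ t → P t → Σ ℕ (Minimal P)) step
  where
    step : ∀ t → (∀ {u} → u < t → P u → Σ ℕ (Minimal P)) → P t → Σ ℕ (Minimal P)
    step t smaller Pt with anyUpTo? P? t
    ... | yes (u , u<t , Pu) = smaller u<t Pu
    ... | no none = t , Pt , λ j<t Pj → none (_ , j<t , Pj)

n<m^n : ∀ {m} → 2 ≤ m → ∀ n → n < m ^ n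
n<m^n {m} 2≤m zero = z<s
n<m^n {m} 2≤m (suc n) = begin-strict
    suc n           <⟨ s≤s (n<m^n 2≤m n) ⟩
    suc (m ^ n)     ≤⟨ +-monoˡ-≤ (m ^ n) (≤-trans (s≤s z≤n) (n<m^n 2≤m n)) ⟩
    m ^ n + m ^ n   ≡⟨ cong (m ^ n +_) (sym (+-identityʳ (m ^ n))) ⟩
    2 * m ^ n       ≤⟨ *-monoˡ-≤ (m ^ n) 2≤m ⟩
    m * m ^ n       ∎
  where open ≤-Reasoning

m∸n≤[o+m]∸[n+p] : ∀ m n {o p} → p ≤ o → m ∸ n ≤ (o + m) ∸ (n + p)
m∸n≤[o+m]∸[n+p] m n {o} {p} p≤o = begin
    m ∸ n               ≡⟨ sym ([m+n]∸[m+o]≡n∸o p m n) ⟩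
    (p + m) ∸ (p + n)   ≤⟨ ∸-mono (+-monoˡ-≤ m p≤o) (≤-reflexive (+-comm n p)) ⟩
    (o + m) ∸ (n + p)   ∎
  where open ≤-Reasoning

/-≤-suc : ∀ {a b} N .{{_ : NonZero N}} → b ≤ a + N → b / N ≤ suc (a / N)
/-≤-suc {a} {b} N b≤a+N = begin
    b / N             ≤⟨ /-monoˡ-≤ N b≤a+N ⟩
    (a + N) / N       ≡⟨ m/n≡1+[m∸n]/n (m≤n+m N a) ⟩
    suc ((a + N ∸ N) / N) ≡⟨ cong (λ t → suc (t / N)) (m+n∸n≡m a N) ⟩
    suc (a / N)       ∎
  where open ≤-Reasoning

/-between : ∀ {a b c} N .{{_ : NonZero N}} → a ≤ c → c ≤ b → b / N ≤ suc (a / N) →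
            c / N ≡ a / N ⊎ c / N ≡ b / N
/-between {a} {b} {c} N a≤c c≤b b≤1+a with c / N ≤? a / N
... | yes c≤a = inj₁ (≤-antisym c≤a (/-monoˡ-≤ N a≤c))
... | no c≰a = inj₂ (≤-antisym (/-monoˡ-≤ N c≤b) (≤-trans b≤1+a (≰⇒> c≰a)))

m*o^j/n≡m*o^k/n/o^[k∸j] : ∀ m {o} n {j k} .{{_ : NonZero o}} .{{_ : NonZero n}} → j ≤ k →
                         m * o ^ j / n ≡ _/_ (m * o ^ k / n) (o ^ (k ∸ j)) {{m^n≢0 o (k ∸ j)}}
m*o^j/n≡m*o^k/n/o^[k∸j] m {o} n {j} {k} j≤k = begin
    m * o ^ j / n                       ≡⟨ m*n/o*n≡m/o (m * o ^ j) (o ^ i) n ⟨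
    m * o ^ j * o ^ i / (n * o ^ i)     ≡⟨ cong (_/ (n * o ^ i)) scale ⟩
    m * o ^ k / (n * o ^ i)             ≡⟨ m/n/o≡m/[n*o] (m * o ^ k) n (o ^ i) ⟨
    m * o ^ k / n / o ^ i               ∎
  where
    open ≡-Reasoning
    i : ℕ
    i = k ∸ j
    instance
      o^i≢0 : NonZero (o ^ i)
      o^i≢0 = m^n≢0 o i
      n*o^i≢0 : NonZero (n * o ^ i)
      n*o^i≢0 = m*n≢0 n (o ^ i)
    scale : m * o ^ j * o ^ i ≡ m * o ^ k
    scale = begin
      m * o ^ j * o ^ i   ≡⟨ *-assoc m (o ^ j) (o ^ i) ⟩
      m * (o ^ j * o ^ i) ≡⟨ cong (m *_) (^-distribˡ-+-* o j i) ⟨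
      m * o ^ (j + i)     ≡⟨ cong (λ e → m * o ^ e) (m+[n∸m]≡n j≤k) ⟩
      m * o ^ k           ∎

floorLog-≥ : ∀ {d n g m} → 2 ≤ d → 0 < g → d ^ m * g ≤ n → m ≤ floorLog d n g
floorLog-≥ {d} {n} {g} {m} 2≤d 0<g d^m*g≤n =
  subst (λ ks → m ≤ length (filter (λ k → d ^ k * g ≤? n) ks)) (sym (map-upTo suc n))
        (length-filter-applyUpTo-≥ (λ k → d ^ k * g ≤? n) suc m≤n below)
  where
    instance
      d≢0 : NonZero d
      d≢0 = >-nonZero (≤-trans (s≤s z≤n) 2≤d)
      g≢0 : NonZero g
      g≢0 = >-nonZero 0<g
    m≤n : m ≤ n
    m≤n = ≤-trans (<⇒≤ (n<m^n 2≤d m)) (≤-trans (m≤m*n (d ^ m) g) d^m*g≤n)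
    below : ∀ {j} → j < m → d ^ suc j * g ≤ n
    below j<m = ≤-trans (*-monoˡ-≤ g (^-monoʳ-≤ d j<m)) d^m*g≤n

module Increasing (x : ℕ → ℕ) (s : ℕ) (x-inc : ∀ i → 1 ≤ i → i ≤ s → x i < x (suc i)) where

  x-mono : ∀ {i} j → 1 ≤ i → i ≤ j → j ≤ suc s → x i ≤ x j
  x-mono {i} zero 1≤i i≤0 _ = ⊥-elim (<⇒≱ 1≤i i≤0)
  x-mono {i} (suc j) 1≤i i≤1+j 1+j≤1+s with m≤n⇒m<n∨m≡n i≤1+j
  ... | inj₂ refl = ≤-refl
  ... | inj₁ (s≤s i≤j) = ≤-trans (x-mono j 1≤i i≤j (m≤n⇒m≤1+n (≤-pred 1+j≤1+s)))
                                 (<⇒≤ (x-inc j (≤-trans 1≤i i≤j) (≤-pred 1+j≤1+s)))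

module Digits (d n : ℕ) (2≤d : 2 ≤ d) (0<n : 0 < n) (x : ℕ → ℕ) (s : ℕ) where
  open Trie d n 2≤d 0<n x s

  instance
    d≢0 : NonZero d
    d≢0 = >-nonZero (≤-trans (s≤s z≤n) 2≤d)
    n≢0 : NonZero n
    n≢0 = >-nonZero 0<n
    dn≢0 : NonZero (d * n)
    dn≢0 = m*n≢0 d n

  leadingDigits : ℕ → ℕ → List ℕ
  leadingDigits k a = applyUpTo (λ j → digit a (suc j)) k

  βLength : ℕ → ℕ
  βLength i = floorLog d n (x (suc i) ∸ x i) + 2

  take-β : ∀ {k} i → k ≤ βLength i → take k (β i) ≡ leadingDigits k (x i + x (suc i))
  take-β {k} i k≤ = begin
      take k (β i)
        ≡⟨ cong (take k ∘ map (digit (x i + x (suc i)))) (map-upTo suc (βLength i)) ⟩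
      take k (map (digit (x i + x (suc i))) (applyUpTo suc (βLength i)))
        ≡⟨ cong (take k) (map-applyUpTo suc (digit (x i + x (suc i))) (βLength i)) ⟩
      take k (leadingDigits (βLength i) (x i + x (suc i)))
        ≡⟨ take-applyUpTo _ k≤ ⟩
      leadingDigits k (x i + x (suc i)) ∎
    where open ≡-Reasoning

  length-take-β : ∀ {k} i → k ≤ βLength i → length (take k (β i)) ≡ k
  length-take-β {k} i k≤ = trans (cong length (take-β i k≤)) (length-applyUpTo _ k)

  -- The first k base-d digits of a / (d n), read as one number.
  shifted : ℕ → ℕ → ℕ
  shifted k a = a * d ^ k / (d * n)

  leadingDigits-cong : ∀ k a b → shifted k a ≡ shifted k b → leadingDigits k a ≡ leadingDigits k b
  leadingDigits-cong k a b same = applyUpTo-cong k (cong (_% d) ∘ shifted-cong)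
    where
      shifted-cong : ∀ {j} → j < k → shifted (suc j) a ≡ shifted (suc j) b
      shifted-cong {j} j<k = begin
          shifted (suc j) a              ≡⟨ m*o^j/n≡m*o^k/n/o^[k∸j] a (d * n) j<k ⟩
          shifted k a / d ^ (k ∸ suc j)  ≡⟨ cong (_/ d ^ (k ∸ suc j)) same ⟩
          shifted k b / d ^ (k ∸ suc j)  ≡⟨ m*o^j/n≡m*o^k/n/o^[k∸j] b (d * n) j<k ⟨
          shifted (suc j) b              ∎
        where
          open ≡-Reasoning
          instance
            d^[k∸1+j]≢0 : NonZero (d ^ (k ∸ suc j))
            d^[k∸1+j]≢0 = m^n≢0 d (k ∸ suc j)

  take-β-cong : ∀ {k i j} → k ≤ βLength i → k ≤ βLength j →
                shifted k (x i + x (suc i)) ≡ shifted k (x j + x (suc j)) → take k (β i) ≡ take k (β j)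
  take-β-cong {k} {i} {j} k≤i k≤j same =
    trans (take-β i k≤i) (trans (leadingDigits-cong k (x i + x (suc i)) (x j + x (suc j)) same) (sym (take-β j k≤j)))

module LeafRange (n s : ℕ) (0<n : 0 < n) (x : ℕ → ℕ) (x-inc : ∀ i → 1 ≤ i → i ≤ s → x i < x (suc i))
                 (d : ℕ) (2≤d : 2 ≤ d) (l r : ℕ) (1≤l : 1 ≤ l) (l<r : l < r) (r≤s : r ≤ s) where
  open Trie d n 2≤d 0<n x s
  open Digits d n 2≤d 0<n x s
  open Increasing x s x-inc

  A : ℕ → ℕ
  A i = x i + x (suc i)

  D : ℕ
  D = A r ∸ A l

  Deep : ℕ → Set
  Deep k = n ≤ d ^ k * D

  LeafCover : Set
  LeafCover = Σ ℕ λ d' → d' ≤ d × Σ (Fin d' → List ℕ) λ v →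
    ((a b : Fin d') → v a ≡ v b → a ≡ b) ×
    ((a : Fin d') → IsNode (v a)) ×
    ((a : Fin d') → Deep (length (v a))) ×
    ((i : ℕ) → l ≤ i → i ≤ r → Σ (Fin d') λ a → Prefix (v a) (β i)) ×
    ((a b : Fin d') → toℕ a < toℕ b → lcp (v a) (v b) ≡ lcp (β l) (β r)) ×
    ((a : Fin d') → 0 < toℕ a → suc (toℕ a) < d' →
      (w : List ℕ) → StrictPrefix (lcp (β l) (β r)) w → StrictPrefix w (v a) → OneChild w)

  l≤r : l ≤ r
  l≤r = <⇒≤ l<r

  x-mono-≤s : ∀ {i j} → 1 ≤ i → i ≤ j → j ≤ s → x i ≤ x j
  x-mono-≤s 1≤i i≤j j≤s = x-mono _ 1≤i i≤j (m≤n⇒m≤1+n j≤s)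

  A-mono : ∀ {i j} → 1 ≤ i → i ≤ j → j ≤ s → A i ≤ A j
  A-mono 1≤i i≤j j≤s = +-mono-≤ (x-mono-≤s 1≤i i≤j j≤s) (x-mono _ z<s (s≤s i≤j) (s≤s j≤s))

  Al<Ar : A l < A r
  Al<Ar = +-mono-<-≤ (<-≤-trans (x-inc l 1≤l (≤-trans l≤r r≤s)) (x-mono-≤s z<s l<r r≤s))
                     (x-mono _ z<s (s≤s l≤r) (s≤s r≤s))

  instance
    D≢0 : NonZero D
    D≢0 = >-nonZero (m<n⇒0<n∸m Al<Ar)

  gap≤D : ∀ {i} → l ≤ i → i ≤ r → x (suc i) ∸ x i ≤ D
  gap≤D {i} l≤i i≤r = ≤-trans
    (∸-mono (x-mono _ z<s (s≤s i≤r) (s≤s r≤s)) (x-mono-≤s 1≤l l≤i (≤-trans i≤r r≤s)))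
    (m∸n≤[o+m]∸[n+p] (x (suc r)) (x l) (x-mono-≤s z<s l<r r≤s))

  minimalDepth : Σ ℕ (Minimal Deep)
  minimalDepth = least-witness (λ k → n ≤? d ^ k * D) n
                               (≤-trans (<⇒≤ (n<m^n 2≤d n)) (m≤m*n (d ^ n) D))

  depth≤βLength : ∀ k → (∀ {j} → j < k → ¬ Deep j) → ∀ {i} → l ≤ i → i ≤ r → k ≤ βLength i
  depth≤βLength zero _ _ _ = z≤n
  depth≤βLength (suc m) shallower {i} l≤i i≤r =
    ≤-trans (s≤s (m≤n⇒m≤1+n m≤floorLog)) (≤-reflexive (+-comm 2 (floorLog d n (x (suc i) ∸ x i))))
    where
      m≤floorLog : m ≤ floorLog d n (x (suc i) ∸ x i)
      m≤floorLog = floorLog-≥ 2≤d (m<n⇒0<n∸m (x-inc i (≤-trans 1≤l l≤i) (≤-trans i≤r r≤s)))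
                     (≤-trans (*-monoʳ-≤ (d ^ m) (gap≤D l≤i i≤r)) (<⇒≤ (≰⇒> (shallower (n<1+n m)))))

  shifted-dichotomy : ∀ m → ¬ Deep m → ∀ {i} → l ≤ i → i ≤ r →
                      shifted (suc m) (A i) ≡ shifted (suc m) (A l) ⊎ shifted (suc m) (A i) ≡ shifted (suc m) (A r)
  shifted-dichotomy m shallow {i} l≤i i≤r =
    /-between (d * n) (*-monoˡ-≤ (d ^ k) (A-mono 1≤l l≤i (≤-trans i≤r r≤s)))
                      (*-monoˡ-≤ (d ^ k) (A-mono (≤-trans 1≤l l≤i) i≤r r≤s))
                      (/-≤-suc (d * n) spread)
    where
      open ≤-Reasoning
      k : ℕ
      k = suc m
      spread : A r * d ^ k ≤ A l * d ^ k + d * n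
      spread = begin
        A r * d ^ k                   ≡⟨ cong (_* d ^ k) (m+[n∸m]≡n (<⇒≤ Al<Ar)) ⟨
        (A l + D) * d ^ k             ≡⟨ *-distribʳ-+ (d ^ k) (A l) D ⟩
        A l * d ^ k + D * d ^ k       ≡⟨ cong (A l * d ^ k +_) (trans (*-comm D (d ^ k)) (*-assoc d (d ^ m) D)) ⟩
        A l * d ^ k + d * (d ^ m * D) ≤⟨ +-monoʳ-≤ (A l * d ^ k) (*-monoʳ-≤ d (<⇒≤ (≰⇒> shallow))) ⟩
        A l * d ^ k + d * n           ∎

  prefix-dichotomy : ∀ k → (∀ {j} → j < k → ¬ Deep j) → ∀ {i} → l ≤ i → i ≤ r →
                     take k (β i) ≡ take k (β l) ⊎ take k (β i) ≡ take k (β r)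
  prefix-dichotomy zero _ _ _ = inj₁ refl
  prefix-dichotomy (suc m) shallower l≤i i≤r with shifted-dichotomy m (shallower (n<1+n m)) l≤i i≤r
  ... | inj₁ same = inj₁ (take-β-cong (depth≤βLength _ shallower l≤i i≤r) (depth≤βLength _ shallower ≤-refl l≤r) same)
  ... | inj₂ same = inj₂ (take-β-cong (depth≤βLength _ shallower l≤i i≤r) (depth≤βLength _ shallower l≤r ≤-refl) same)

  prefix-IsNode : ∀ k {i} → 1 ≤ i → i ≤ s → IsNode (take k (β i))
  prefix-IsNode k {i} 1≤i i≤s = i , 1≤i , i≤s , take-Prefix k (β i)

  prefix-Deep : ∀ {k} i → Deep k → k ≤ βLength i → Deep (length (take k (β i)))
  prefix-Deep i deep k≤ = subst Deep (sym (length-take-β i k≤)) deep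

  leafCover-at : ∀ k → Deep k → k ≤ βLength l → k ≤ βLength r →
                 (∀ {i} → l ≤ i → i ≤ r → take k (β i) ≡ take k (β l) ⊎ take k (β i) ≡ take k (β r)) →
                 LeafCover
  leafCover-at k deep k≤l k≤r dichotomy with ≡-dec _≟_ (take k (β l)) (take k (β r))
  ... | yes same = 1 , ≤-trans (s≤s z≤n) 2≤d , (λ _ → take k (β l)) , (λ { zero zero _ → refl }) ,
                   (λ _ → prefix-IsNode k 1≤l (≤-trans l≤r r≤s)) , (λ _ → prefix-Deep l deep k≤l) ,
                   cover , (λ { zero zero () }) , (λ { zero () })
    where
      cover : (i : ℕ) → l ≤ i → i ≤ r → Σ (Fin 1) λ _ → Prefix (take k (β l)) (β i)
      cover i l≤i i≤r with dichotomy l≤i i≤r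
      ... | inj₁ e = zero , take≡⇒Prefix e
      ... | inj₂ e = zero , take≡⇒Prefix (trans e (sym same))
  ... | no differ = 2 , 2≤d , v , injective , node , deep′ , cover , branch , (λ { (suc zero) _ (s≤s (s≤s ())) })
    where
      v : Fin 2 → List ℕ
      v zero = take k (β l)
      v (suc zero) = take k (β r)
      injective : (a b : Fin 2) → v a ≡ v b → a ≡ b
      injective zero zero _ = refl
      injective zero (suc zero) e = ⊥-elim (differ e)
      injective (suc zero) zero e = ⊥-elim (differ (sym e))
      injective (suc zero) (suc zero) _ = refl
      node : (a : Fin 2) → IsNode (v a)
      node zero = prefix-IsNode k 1≤l (≤-trans l≤r r≤s)
      node (suc zero) = prefix-IsNode k (≤-trans 1≤l l≤r) r≤s
      deep′ : (a : Fin 2) → Deep (length (v a))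
      deep′ zero = prefix-Deep l deep k≤l
      deep′ (suc zero) = prefix-Deep r deep k≤r
      cover : (i : ℕ) → l ≤ i → i ≤ r → Σ (Fin 2) λ a → Prefix (v a) (β i)
      cover i l≤i i≤r with dichotomy l≤i i≤r
      ... | inj₁ e = zero , take≡⇒Prefix e
      ... | inj₂ e = suc zero , take≡⇒Prefix e
      branch : (a b : Fin 2) → toℕ a < toℕ b → lcp (v a) (v b) ≡ lcp (β l) (β r)
      branch zero (suc zero) _ = lcp-take k (β l) (β r) differ
      branch (suc zero) (suc zero) (s≤s ())

lemma9 : (n s : ℕ) → (0<n : 0 < n) → 1 ≤ s → (x : ℕ → ℕ) →
         x 1 ≡ 1 → x (suc s) ≡ n → ((i : ℕ) → 1 ≤ i → i ≤ s → x i < x (suc i)) →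
         (d : ℕ) → (2≤d : 2 ≤ d) →
         let open Trie d n 2≤d 0<n x s in
         (l r : ℕ) → 1 ≤ l → l < r → r ≤ s →
         Σ ℕ λ d' → d' ≤ d × Σ (Fin d' → List ℕ) λ v →
           ((a b : Fin d') → v a ≡ v b → a ≡ b) ×
           ((a : Fin d') → IsNode (v a)) ×
           ((a : Fin d') → n ≤ d ^ length (v a) * ((x r + x (suc r)) ∸ (x l + x (suc l)))) ×
           ((i : ℕ) → l ≤ i → i ≤ r → Σ (Fin d') λ a → Prefix (v a) (β i)) ×
           ((a b : Fin d') → toℕ a < toℕ b → lcp (v a) (v b) ≡ lcp (β l) (β r)) ×
           ((a : Fin d') → 0 < toℕ a → suc (toℕ a) < d' →
             (w : List ℕ) → StrictPrefix (lcp (β l) (β r)) w → StrictPrefix w (v a) → OneChild w)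
lemma9 n s 0<n _ x _ _ x-inc d 2≤d l r 1≤l l<r r≤s =
  let open LeafRange n s 0<n x x-inc d 2≤d l r 1≤l l<r r≤s
      (k , deep , shallower) = minimalDepth
  in leafCover-at k deep (depth≤βLength k shallower ≤-refl l≤r) (depth≤βLength k shallower l≤r ≤-refl)
                  (prefix-dichotomy k shallower)
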